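{- For every MDSP instance with $m$ drones, where $\Delta$ is the maximum degree of the interval graph of the delivery intervals, the solution $S_1,\dots,S_m$ output by the algorithm GreedyAlgoForMDSP (described in the context) satisfies $\sum_{i=1}^m\mathcal{P}(S_i)\ge \frac{m}{2(m+\Delta)}\,f(m)$.
   Context: An MDSP instance consists of deliveries $\mathcal{N}=\{1,\dots,n\}$ and $m$ drones, each with the same battery budget $B>0$. Each delivery $j$ has a closed delivery time interval $I_j=[t_j^L,t_j^R]$, a cost $c_j>0$ with $c_j\le B$, and a profit $p_j\ge 0$. Deliveries $j\ne k$ are compatible if $I_j\cap I_k=\emptyset$. A set $S\subseteq\mathcal{N}$ is compatible if its elements are pairwise compatible and feasible if additionally $\mathcal{W}(S)=\sum_{j\in S}c_j\le B$; its profit is $\mathcal{P}(S)=\sum_{j\in S}p_j$. $f(m)$ denotes the maximum of $\sum_{i=1}^m\mathcal{P}(T_i)$ over pairwise disjoint feasible sets $T_1,\dots,T_m$. The density of $j$ is $d_j=p_j/c_j$. The interval graph has vertex set $\mathcal{N}$ and an edge between $j\neq k$ iff $I_j\cap I_k\neq\emptyset$; $\Delta$ is its maximum degree. Algorithm GreedyAlgoForMDSP: Use $m+\Delta$ slots $i=1,\dots,m+\Delta$, each with a set $S_i$ (initially $\emptyset$), cost $W_i=\mathcal{W}(S_i)$ and profit $P_i=\mathcal{P}(S_i)$; let $M$ (initially all slots) be the open slots and $M'$ (initially $\emptyset$) the closed slots. Sort the deliveries so that $d_1\ge d_2\ge\dots\ge d_n$. For $j=1,\dots,n$: if $|M'|=m$,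 stop the loop; otherwise choose a slot $i\in M$ such that $I_j$ is disjoint from every interval $I_k$ with $k\in S_i$, and add $j$ to $S_i$ (updating $W_i,P_i$); if now $W_i>B$, move $i$ from $M$ to $M'$ and set $L_i=\{j\}$. After the loop, for each $i\in M'$: if $\mathcal{P}(S_i\setminus L_i)\ge\mathcal{P}(L_i)$, replace $S_i$ by $S_i\setminus L_i$; otherwise replace $S_i$ by $L_i$ (updating $W_i,P_i$). Finally output the $m$ slots with the largest $P_i$ among all $m+\Delta$ slots, together with their sets $S_i$.
   Formalization: The battery budget $B$, the costs $c_j$, the profits $p_j$ and the interval endpoints $t_j^L$, $t_j^R$ of each MDSP instance are rational. -}

module Defs where

open import Data.Nat as ℕ using (ℕ; zero; suc)
open import Data.Fin using (Fin; zero; suc) renaming (_≟_ to _≟ᶠ_)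
open import Data.Fin.Subset using (Subset; ⁅_⁆; _∪_; _─_; ∣_∣; _∈_; _∉_; inside; outside)
open import Data.Vec using (Vec; []; _∷_; tabulate)
open import Data.Bool using (Bool; true; false; if_then_else_)
open import Data.Maybe using (Maybe; just; nothing; is-just)
open import Data.Rational using (ℚ; 0ℚ; _+_; _*_; _≤_; _<_; _÷_; >-nonZero)
open import Data.Rational.Properties using (_≤?_)
open import Data.List using (List; []; _∷_; allFin)
open import Data.List.Relation.Binary.Permutation.Propositional using (_↭_)
open import Data.List.Relation.Unary.Linked using (Linked)
open import Data.Product using (Σ; ∃; _×_; _,_)
open import Function.Bundles using (_⇔_)
open import Function.Definitions using (Injective)
open import Relation.Nullary using (¬_; does)
open import Relation.Binary.PropositionalEquality using (_≡_; _≢_)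

Σᶠ : ∀ {k} → (Fin k → ℚ) → ℚ
Σᶠ {zero}  f = 0ℚ
Σᶠ {suc k} f = f zero + Σᶠ (λ i → f (suc i))

Σ∈ : ∀ {n} → Subset n → (Fin n → ℚ) → ℚ
Σ∈ []            f = 0ℚ
Σ∈ (true  ∷ S)   f = f zero + Σ∈ S (λ i → f (suc i))
Σ∈ (false ∷ S)   f = Σ∈ S (λ i → f (suc i))

-- MDSP instances: n deliveries (indexed by Fin n), battery budget B.
-- (The number m of drones is a separate parameter.)

record Instance (n : ℕ) : Set where
  field
    B    : ℚ
    tL   : Fin n → ℚ
    tR   : Fin n → ℚ
    c    : Fin n → ℚ
    p    : Fin n → ℚ
    B>0  : 0ℚ < B
    tL≤tR : ∀ j → tL j ≤ tR j
    c>0  : ∀ j → 0ℚ < c j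
    c≤B  : ∀ j → c j ≤ B
    p≥0  : ∀ j → 0ℚ ≤ p j

module _ {n : ℕ} (I : Instance n) where
  open Instance I

  InInterval : ℚ → Fin n → Set
  InInterval x j = tL j ≤ x × x ≤ tR j

  Intersect : Fin n → Fin n → Set
  Intersect j k = ∃ λ x → InInterval x j × InInterval x k

  DisjointIntervals : Fin n → Fin n → Set
  DisjointIntervals j k = ¬ Intersect j k

  Compatible : Subset n → Set
  Compatible S = ∀ j k → j ∈ S → k ∈ S → j ≢ k → DisjointIntervals j k

  W : Subset n → ℚ
  W S = Σ∈ S c

  P : Subset n → ℚ
  P S = Σ∈ S p

  Feasible : Subset n → Set
  Feasible S = Compatible S × W S ≤ B

  density : Fin n → ℚ
  density j = _÷_ (p j) (c j) {{>-nonZero (c>0 j)}}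

  -- f(m): the maximum total profit of m pairwise disjoint feasible sets

  PairwiseDisjoint : ∀ {m} → (Fin m → Subset n) → Set
  PairwiseDisjoint {m} T = ∀ (i i' : Fin m) (j : Fin n) → j ∈ T i → j ∈ T i' → i ≡ i'

  Admissible : (m : ℕ) → (Fin m → Subset n) → Set
  Admissible m T = PairwiseDisjoint T × (∀ i → Feasible (T i))

  IsOptimum : ℕ → ℚ → Set
  IsOptimum m v =
    (Σ (Fin m → Subset n) λ T → Admissible m T × Σᶠ (λ i → P (T i)) ≡ v)
    × (∀ (T : Fin m → Subset n) → Admissible m T → Σᶠ (λ i → P (T i)) ≤ v)

  HasDegree : Fin n → ℕ → Set
  HasDegree j d = Σ (Subset n) λ N →
    (∀ k → (k ∈ N) ⇔ (k ≢ j × Intersect j k)) × ∣ N ∣ ≡ d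

  IsMaxDegree : ℕ → Set
  IsMaxDegree Δ =
    (∀ j d → HasDegree j d → d ℕ.≤ Δ)
    × (∀ Δ' → (∀ j d → HasDegree j d → d ℕ.≤ Δ') → Δ ℕ.≤ Δ')

  -- state of the main loop: for each slot i its set S_i, and
  -- L i = just j  iff  slot i is closed (i ∈ M') with L_i = {j};
  -- L i = nothing iff slot i is open (i ∈ M).
  record AlgState (K : ℕ) : Set where
    constructor ⟨_,_⟩
    field
      S : Fin K → Subset n
      L : Fin K → Maybe (Fin n)
  open AlgState public

  initState : ∀ K → AlgState K
  initState K = ⟨ (λ _ → Data.Fin.Subset.⊥) , (λ _ → nothing) ⟩

  closedSlots : ∀ {K} → AlgState K → Subset K
  closedSlots s = tabulate (λ i → is-just (L s i))

  update : ∀ {K} {A : Set} → (Fin K → A) → Fin K → A → Fin K → A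
  update f i x i' = if does (i' ≟ᶠ i) then x else f i'

  FitsIn : ∀ {K} → AlgState K → Fin K → Fin n → Set
  FitsIn s i j = ∀ k → k ∈ S s i → DisjointIntervals j k

  -- the main loop, processing the deliveries in the given order;
  -- Loop m s js s' : starting in state s with remaining deliveries js,
  -- the loop can end in state s'  (the choice of slot is arbitrary)
  data Loop (m : ℕ) {K : ℕ} : AlgState K → List (Fin n) → AlgState K → Set where
    finished : ∀ {s} → Loop m s [] s
    stop     : ∀ {s j js} → ∣ closedSlots s ∣ ≡ m → Loop m s (j ∷ js) s
    addFit   : ∀ {s j js s'} (i : Fin K) →
               ∣ closedSlots s ∣ ≢ m → L s i ≡ nothing → FitsIn s i j →
               W (S s i ∪ ⁅ j ⁆) ≤ B →
               Loop m ⟨ update (S s) i (S s i ∪ ⁅ j ⁆) , L s ⟩ js s' →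
               Loop m s (j ∷ js) s'
    addClose : ∀ {s j js s'} (i : Fin K) →
               ∣ closedSlots s ∣ ≢ m → L s i ≡ nothing → FitsIn s i j →
               B < W (S s i ∪ ⁅ j ⁆) →
               Loop m ⟨ update (S s) i (S s i ∪ ⁅ j ⁆) , update (L s) i (just j) ⟩ js s' →
               Loop m s (j ∷ js) s'

  finalSet : ∀ {K} → AlgState K → Fin K → Subset n
  finalSet s i with L s i
  ... | nothing = S s i
  ... | just j  = if does (P ⁅ j ⁆ ≤? P (S s i ─ ⁅ j ⁆))
                  then S s i ─ ⁅ j ⁆
                  else ⁅ j ⁆

  DensityOrder : List (Fin n) → Set
  DensityOrder ord =
    (ord ↭ allFin n) × Linked (λ j k → density k ≤ density j) ord

  TopSlots : ∀ {K} (m : ℕ) → (Fin K → Subset n) → (Fin m → Fin K) → Set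
  TopSlots {K} m F sel =
    Injective _≡_ _≡_ sel ×
    (∀ (a : Fin m) (i : Fin K) → (∀ b → sel b ≢ i) → P (F i) ≤ P (F (sel a)))

  GreedyOutput : (m Δ : ℕ) → (Fin m → Subset n) → Set
  GreedyOutput m Δ out =
    Σ (List (Fin n)) λ ord → DensityOrder ord ×
    Σ (AlgState (m ℕ.+ Δ)) λ s → Loop m (initState (m ℕ.+ Δ)) ord s ×
    Σ (Fin m → Fin (m ℕ.+ Δ)) λ sel → TopSlots m (finalSet s) sel ×
    (∀ a → out a ≡ finalSet s (sel a))

-- The loop puts every delivery into at most one slot, in order of decreasing
-- density. If it processes all deliveries, the slots contain all of them; if it
-- halts, m slots are overfull, so the slots weigh more than m·B while no
-- unprocessed delivery is denser than a processed one. In both cases a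
-- fractional-knapsack exchange argument shows that the slots carry at least the
-- profit of any m disjoint feasible sets, hence at least f(m). Keeping the better
-- of the last delivery and the rest of an overfull slot loses at most half, and
-- by Chebyshev's sum inequality the m most profitable of the m + Δ slots carry at
-- least an m/(m + Δ) share of the total. Neither Δ nor the interval constraints
-- enter the bound: they only guarantee that some open slot accepts each delivery.

module Submission where

open import Defs
open import Data.Nat using (ℕ)
open import Data.Fin using (Fin)
open import Data.Fin.Subset using (Subset)
open import Data.Integer using (+_)
open import Data.Rational using (ℚ; _≤_; _*_; _/_)

open import Algebra.Bundles using (CommutativeRing)
open import Data.Bool using (Bool; true; false; if_then_else_; _∨_)
open import Data.Bool.Properties using (¬-not; ∨-identityʳ)
open import Data.Empty using (⊥-elim)
open import Data.Fin using (zero; suc) renaming (_≟_ to _≟ᶠ_)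
open import Data.Fin.Properties using (any?; suc-injective)
open import Data.Fin.Subset using (⁅_⁆; _∪_; _─_; _∈_; _∉_; ∣_∣; outside) renaming (⊥ to ∅)
open import Data.Fin.Subset.Properties using (_∈?_; x∈⁅y⁆⇒x≡y; x∈⁅x⁆; x∈p∪q⁺; x∈p∪q⁻; ∉⊥)
import Data.Integer as ℤ
import Data.Integer.Properties as ℤ
open import Data.List using (List; []; _∷_)
open import Data.List.Membership.Propositional using () renaming (_∈_ to _∈ˡ_; _∉_ to _∉ˡ_)
open import Data.List.Membership.Propositional.Properties using (∈-allFin)
open import Data.List.Relation.Binary.Permutation.Propositional using (↭-sym; ↭⇒↭ₛ)
open import Data.List.Relation.Binary.Permutation.Propositional.Properties using (∈-resp-↭)
import Data.List.Relation.Unary.All as All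
open import Data.List.Relation.Unary.AllPairs as AllPairs using (AllPairs)
open import Data.List.Relation.Unary.Any using (here; there)
open import Data.List.Relation.Unary.Linked.Properties using (Linked⇒AllPairs)
open import Data.List.Relation.Unary.Unique.Propositional using (Unique)
open import Data.List.Relation.Unary.Unique.Propositional.Properties using (allFin⁺)
open import Data.Maybe using (just; nothing)
import Data.Nat as ℕ
import Data.Nat.Properties as ℕ
open import Data.Product using (∃-syntax; _×_; _,_; proj₁; proj₂)
open import Data.Rational using (0ℚ; 1ℚ; _+_; _-_; -_; 1/_; _<_; nonNegative; positive; >-nonZero)
open import Data.Rational.Properties
open import Data.Rational.Solver using (module +-*-Solver)
import Data.Rational.Unnormalised as ℚᵘ
import Data.Rational.Unnormalised.Properties as ℚᵘ
open import Data.Sum using (_⊎_; inj₁; inj₂)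
open import Data.Vec using (lookup; []; _∷_)
open import Data.Vec.Properties using (lookup⇒[]=; []=⇒lookup; lookup-replicate; lookup-zipWith)
open import Function using (_∘_)
open import Function.Definitions using (Injective)
open import Relation.Binary.PropositionalEquality
open import Relation.Nullary using (Dec; does; yes; no; contradiction)
open import Relation.Nullary.Decidable using (dec-true; dec-false)

open import Algebra.Properties.Semiring.Sum (CommutativeRing.semiring +-*-commutativeRing)
  using (sum; sum-syntax; sum-cong-≗; ∑-distrib-+; ∑-comm; *-distribˡ-sum; *-distribʳ-sum)
open +-*-Solver using (solve; _:=_; _:+_; _:*_; _:-_; con)

-- + k / 1 is fromℚᵘ (mkℚᵘ (+ k) 0), so the identity can be checked on unnormalised rationals.
/1-homo-+ : ∀ a b → + (a ℕ.+ b) / 1 ≡ + a / 1 + + b / 1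
/1-homo-+ a b = toℚᵘ-injective (ℚᵘ.≃-trans (toℚᵘ-fromℚᵘ (ℚᵘ.mkℚᵘ (+ (a ℕ.+ b)) 0))
  (ℚᵘ.≃-trans (ℚᵘ.*≡* cross) (ℚᵘ.≃-sym (ℚᵘ.≃-trans (toℚᵘ-homo-+ (+ a / 1) (+ b / 1))
    (ℚᵘ.+-cong (toℚᵘ-fromℚᵘ (ℚᵘ.mkℚᵘ (+ a) 0)) (toℚᵘ-fromℚᵘ (ℚᵘ.mkℚᵘ (+ b) 0)))))))
  where
  cross : + (a ℕ.+ b) ℤ.* (+ 1 ℤ.* + 1) ≡ (+ a ℤ.* + 1 ℤ.+ + b ℤ.* + 1) ℤ.* + 1
  cross rewrite ℤ.*-identityʳ (+ a) | ℤ.*-identityʳ (+ b) | ℤ.*-identityʳ (+ a ℤ.+ + b) = refl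

p≤q⇒0≤q-p : ∀ {p q} → p ≤ q → 0ℚ ≤ q - p
p≤q⇒0≤q-p {p} {q} h = subst (_≤ q - p) (+-inverseʳ p) (+-monoˡ-≤ (- p) h)

0≤q-p⇒p≤q : ∀ {p q} → 0ℚ ≤ q - p → p ≤ q
0≤q-p⇒p≤q {p} {q} h =
  subst₂ _≤_ (+-identityˡ p) (solve 2 (λ p q → q :- p :+ p := q) refl p q) (+-monoˡ-≤ p h)

nonNeg*nonNeg : ∀ {p q} → 0ℚ ≤ p → 0ℚ ≤ q → 0ℚ ≤ p * q
nonNeg*nonNeg {p} {q} hp hq = subst (_≤ p * q) (*-zeroˡ q) (*-monoʳ-≤-nonNeg q {{nonNegative hq}} hp)

+-cancelʳ-≤ : ∀ {p q} r → p + r ≤ q + r → p ≤ q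
+-cancelʳ-≤ {p} {q} r h = 0≤q-p⇒p≤q
  (subst (0ℚ ≤_) (solve 3 (λ p q r → q :+ r :- (p :+ r) := q :- p) refl p q r) (p≤q⇒0≤q-p h))

p+p≤q+q⇒p≤q : ∀ {p q} → p + p ≤ q + q → p ≤ q
p+p≤q+q⇒p≤q h = ≮⇒≥ (λ q<p → <-irrefl refl (<-≤-trans (+-mono-< q<p q<p) h))

Σᶠ≡sum : ∀ {n} (f : Fin n → ℚ) → Σᶠ f ≡ sum f
Σᶠ≡sum {ℕ.zero}  f = refl
Σᶠ≡sum {ℕ.suc n} f = cong (λ s → f zero + s) (Σᶠ≡sum (f ∘ suc))

sum-mono-≤ : ∀ {n} {f g : Fin n → ℚ} → (∀ i → f i ≤ g i) → sum f ≤ sum g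
sum-mono-≤ {ℕ.zero}  h = ≤-refl
sum-mono-≤ {ℕ.suc n} h = +-mono-≤ (h zero) (sum-mono-≤ (h ∘ suc))

sum-const : ∀ n x → ∑[ i < n ] x ≡ (+ n / 1) * x
sum-const ℕ.zero    x = sym (*-zeroˡ x)
sum-const (ℕ.suc n) x = begin
  x + ∑[ i < n ] x        ≡⟨ cong (λ s → x + s) (sum-const n x) ⟩
  x + (+ n / 1) * x       ≡⟨ solve 2 (λ x y → x :+ y :* x := (con 1ℚ :+ y) :* x) refl x (+ n / 1) ⟩
  (1ℚ + + n / 1) * x      ≡⟨ cong (_* x) (/1-homo-+ 1 n) ⟨
  (+ ℕ.suc n / 1) * x     ∎
  where open ≡-Reasoning

χ : Bool → ℚ
χ b = if b then 1ℚ else 0ℚ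

sum-χ-none : ∀ {m} (b : Fin m → Bool) → (∀ a → b a ≡ false) → sum (χ ∘ b) ≡ 0ℚ
sum-χ-none {ℕ.zero}  b none = refl
sum-χ-none {ℕ.suc m} b none rewrite none zero = trans (+-identityˡ _) (sum-χ-none (b ∘ suc) (none ∘ suc))

sum-χ-unique : ∀ {m} (b : Fin m → Bool) a → b a ≡ true → (∀ a′ → b a′ ≡ true → a′ ≡ a) →
               sum (χ ∘ b) ≡ 1ℚ
sum-χ-unique b zero ba unique rewrite ba =
  trans (cong (λ s → 1ℚ + s) (sum-χ-none (b ∘ suc) (λ a → ¬-not (λ ba′ → contradiction (unique (suc a) ba′) λ ()))))
        (+-identityʳ 1ℚ)
sum-χ-unique b (suc a) ba unique with b zero in b0
... | true  = contradiction (unique zero b0) λ ()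
... | false = trans (+-identityˡ _) (sum-χ-unique (b ∘ suc) a ba (λ a′ e → suc-injective (unique (suc a′) e)))

Σ∈≡sum-χ : ∀ {n} (S : Subset n) f → Σ∈ S f ≡ ∑[ k < n ] (χ (lookup S k) * f k)
Σ∈≡sum-χ []          f = refl
Σ∈≡sum-χ (true  ∷ S) f = cong₂ _+_ (sym (*-identityˡ (f zero))) (Σ∈≡sum-χ S (f ∘ suc))
Σ∈≡sum-χ (false ∷ S) f = begin
  Σ∈ S (f ∘ suc)            ≡⟨ Σ∈≡sum-χ S (f ∘ suc) ⟩
  tail-sum                  ≡⟨ +-identityˡ tail-sum ⟨
  0ℚ + tail-sum             ≡⟨ cong (_+ tail-sum) (*-zeroˡ (f zero)) ⟨
  0ℚ * f zero + tail-sum    ∎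
  where
  open ≡-Reasoning
  tail-sum = ∑[ k < _ ] (χ (lookup S k) * f (suc k))

Σ∈-∅ : ∀ {n} (f : Fin n → ℚ) → Σ∈ ∅ f ≡ 0ℚ
Σ∈-∅ {ℕ.zero}  f = refl
Σ∈-∅ {ℕ.suc n} f = Σ∈-∅ (f ∘ suc)

Σ∈-⁅⁆ : ∀ {n} (j : Fin n) f → Σ∈ ⁅ j ⁆ f ≡ f j
Σ∈-⁅⁆ zero    f = trans (cong (λ s → f zero + s) (Σ∈-∅ (f ∘ suc))) (+-identityʳ (f zero))
Σ∈-⁅⁆ (suc j) f = Σ∈-⁅⁆ j (f ∘ suc)

lookup-⁅⁆ : ∀ {n} (j k : Fin n) → lookup ⁅ j ⁆ k ≡ does (k ≟ᶠ j)
lookup-⁅⁆ zero    zero    = refl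
lookup-⁅⁆ zero    (suc k) = lookup-replicate k outside
lookup-⁅⁆ (suc j) zero    = refl
lookup-⁅⁆ (suc j) (suc k) with k ≟ᶠ j | lookup-⁅⁆ j k
... | yes _ | e = e
... | no  _ | e = e

lookup-∪-⁅⁆ : ∀ {n} (S : Subset n) {j k} → k ≢ j → lookup (S ∪ ⁅ j ⁆) k ≡ lookup S k
lookup-∪-⁅⁆ S {j} {k} k≢j = begin
  lookup (S ∪ ⁅ j ⁆) k          ≡⟨ lookup-zipWith _∨_ k S ⁅ j ⁆ ⟩
  lookup S k ∨ lookup ⁅ j ⁆ k   ≡⟨ cong (lookup S k ∨_) (trans (lookup-⁅⁆ j k) (dec-false (k ≟ᶠ j) k≢j)) ⟩
  lookup S k ∨ false            ≡⟨ ∨-identityʳ (lookup S k) ⟩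
  lookup S k                    ∎
  where open ≡-Reasoning

-- _─_ uses a where-bound helper and so does not unfold along _∷_; subsets are
-- therefore split pointwise, through lookup.
lookup-─ : ∀ {n} (p q : Subset n) k → lookup (p ─ q) k ≡ (if lookup q k then false else lookup p k)
lookup-─ (_ ∷ p) (true  ∷ q) zero    = refl
lookup-─ (_ ∷ p) (false ∷ q) zero    = refl
lookup-─ (_ ∷ p) (_     ∷ q) (suc k) = lookup-─ p q k

Σ∈-split : ∀ {n} {S : Subset n} {j} f → j ∈ S → Σ∈ S f ≡ Σ∈ (S ─ ⁅ j ⁆) f + Σ∈ ⁅ j ⁆ f
Σ∈-split {n} {S} {j} f j∈S = begin
  Σ∈ S f                                         ≡⟨ Σ∈≡sum-χ S f ⟩
  ∑[ k < n ] (χ (lookup S k) * f k)              ≡⟨ sum-cong-≗ split ⟩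
  ∑[ k < n ] (χ (lookup (S ─ ⁅ j ⁆) k) * f k + χ (lookup ⁅ j ⁆ k) * f k)
                                                 ≡⟨ ∑-distrib-+ (λ k → χ (lookup (S ─ ⁅ j ⁆) k) * f k)
                                                                 (λ k → χ (lookup ⁅ j ⁆ k) * f k) ⟩
  ∑[ k < n ] (χ (lookup (S ─ ⁅ j ⁆) k) * f k) + ∑[ k < n ] (χ (lookup ⁅ j ⁆ k) * f k)
                                                 ≡⟨ cong₂ _+_ (Σ∈≡sum-χ (S ─ ⁅ j ⁆) f) (Σ∈≡sum-χ ⁅ j ⁆ f) ⟨
  Σ∈ (S ─ ⁅ j ⁆) f + Σ∈ ⁅ j ⁆ f                  ∎
  where
  open ≡-Reasoning
  split : ∀ k → χ (lookup S k) * f k ≡ χ (lookup (S ─ ⁅ j ⁆) k) * f k + χ (lookup ⁅ j ⁆ k) * f k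
  split k rewrite lookup-─ S ⁅ j ⁆ k | lookup-⁅⁆ j k with k ≟ᶠ j
  ... | yes refl rewrite []=⇒lookup j∈S = sym (trans (cong (_+ 1ℚ * f k) (*-zeroˡ (f k))) (+-identityˡ _))
  ... | no  _    = sym (trans (cong (λ s → χ (lookup S k) * f k + s) (*-zeroˡ (f k))) (+-identityʳ _))

Σ∈-nonNeg : ∀ {n} (S : Subset n) {f} → (∀ k → 0ℚ ≤ f k) → 0ℚ ≤ Σ∈ S f
Σ∈-nonNeg []          f≥0 = ≤-refl
Σ∈-nonNeg (true  ∷ S) {f} f≥0 =
  subst (_≤ f zero + Σ∈ S (f ∘ suc)) (+-identityˡ 0ℚ) (+-mono-≤ (f≥0 zero) (Σ∈-nonNeg S (f≥0 ∘ suc)))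
Σ∈-nonNeg (false ∷ S) f≥0 = Σ∈-nonNeg S (f≥0 ∘ suc)

multiplicity : ∀ {K n} → (Fin K → Subset n) → Fin n → ℚ
multiplicity {K} X k = ∑[ i < K ] χ (lookup (X i) k)

sum-Σ∈≡sum-multiplicity : ∀ {K n} (X : Fin K → Subset n) f →
  ∑[ i < K ] Σ∈ (X i) f ≡ ∑[ k < n ] (multiplicity X k * f k)
sum-Σ∈≡sum-multiplicity {K} {n} X f = begin
  ∑[ i < K ] Σ∈ (X i) f
    ≡⟨ sum-cong-≗ (λ i → Σ∈≡sum-χ (X i) f) ⟩
  ∑[ i < K ] ∑[ k < n ] (χ (lookup (X i) k) * f k)
    ≡⟨ ∑-comm (λ i k → χ (lookup (X i) k) * f k) ⟩
  ∑[ k < n ] ∑[ i < K ] (χ (lookup (X i) k) * f k)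
    ≡⟨ sum-cong-≗ (λ k → *-distribʳ-sum (f k) (λ i → χ (lookup (X i) k))) ⟨
  ∑[ k < n ] (multiplicity X k * f k)
    ∎
  where open ≡-Reasoning

multiplicity-none : ∀ {K n} (X : Fin K → Subset n) {k} → (∀ i → k ∉ X i) → multiplicity X k ≡ 0ℚ
multiplicity-none X {k} k∉ = sum-χ-none _ (λ i → ¬-not (k∉ i ∘ lookup⇒[]= k (X i)))

multiplicity-unique : ∀ {K n} (X : Fin K → Subset n) {k i} → k ∈ X i → (∀ i′ → k ∈ X i′ → i′ ≡ i) →
  multiplicity X k ≡ 1ℚ
multiplicity-unique X {k} {i} k∈Xi unique =
  sum-χ-unique _ i ([]=⇒lookup k∈Xi) (λ i′ e → unique i′ (lookup⇒[]= k (X i′) e))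

multiplicity-disjoint : ∀ {K n} (X : Fin K → Subset n) →
  (∀ i i′ k → k ∈ X i → k ∈ X i′ → i ≡ i′) → ∀ k →
  (∃[ i ] k ∈ X i × multiplicity X k ≡ 1ℚ) ⊎ ((∀ i → k ∉ X i) × multiplicity X k ≡ 0ℚ)
multiplicity-disjoint X disjoint k with any? (λ i → k ∈? X i)
... | yes (i , k∈Xi) = inj₁ (i , k∈Xi , multiplicity-unique X k∈Xi (λ i′ k∈Xi′ → disjoint i′ i k k∈Xi′ k∈Xi))
... | no ∄i = inj₂ (k∉ , multiplicity-none X k∉)
  where
  k∉ : ∀ i → k ∉ X i
  k∉ i k∈Xi = ∄i (i , k∈Xi)

-- Summing the hypothesis over all i and j gives 2 (K Σab − Σa Σb) ≥ 0.
chebyshev : ∀ {K} (a b : Fin K → ℚ) → (∀ i j → 0ℚ ≤ (a j - a i) * (b j - b i)) →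
  sum a * sum b ≤ (+ K / 1) * ∑[ i < K ] (a i * b i)
chebyshev {K} a b similarlyOrdered = p+p≤q+q⇒p≤q (begin
  sum a * sum b + sum a * sum b                   ≡⟨ mixed-sum ⟨
  ∑[ i < K ] ∑[ j < K ] (a j * b i + a i * b j)   ≤⟨ sum-mono-≤ (λ i → sum-mono-≤ (rearrangement i)) ⟩
  ∑[ i < K ] ∑[ j < K ] (a j * b j + a i * b i)   ≡⟨ diagonal-sum ⟩
  (+ K / 1) * Σab + (+ K / 1) * Σab               ∎)
  where
  open ≤-Reasoning
  Σab = ∑[ i < K ] (a i * b i)
  rearrangement : ∀ i j → a j * b i + a i * b j ≤ a j * b j + a i * b i
  rearrangement i j = 0≤q-p⇒p≤q (subst (0ℚ ≤_)
    (solve 4 (λ ai aj bi bj → (aj :- ai) :* (bj :- bi) := aj :* bj :+ ai :* bi :- (aj :* bi :+ ai :* bj))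
           refl (a i) (a j) (b i) (b j))
    (similarlyOrdered i j))
  mixed-sum : ∑[ i < K ] ∑[ j < K ] (a j * b i + a i * b j) ≡ sum a * sum b + sum a * sum b
  mixed-sum = begin-equality
    ∑[ i < K ] ∑[ j < K ] (a j * b i + a i * b j)
      ≡⟨ sum-cong-≗ (λ i → ∑-distrib-+ (λ j → a j * b i) (λ j → a i * b j)) ⟩
    ∑[ i < K ] (∑[ j < K ] (a j * b i) + ∑[ j < K ] (a i * b j))
      ≡⟨ sum-cong-≗ (λ i → cong₂ _+_ (*-distribʳ-sum (b i) a) (*-distribˡ-sum (a i) b)) ⟨
    ∑[ i < K ] (sum a * b i + a i * sum b)
      ≡⟨ ∑-distrib-+ (λ i → sum a * b i) (λ i → a i * sum b) ⟩
    ∑[ i < K ] (sum a * b i) + ∑[ i < K ] (a i * sum b)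
      ≡⟨ cong₂ _+_ (*-distribˡ-sum (sum a) b) (*-distribʳ-sum (sum b) a) ⟨
    sum a * sum b + sum a * sum b ∎
  diagonal-sum : ∑[ i < K ] ∑[ j < K ] (a j * b j + a i * b i) ≡ (+ K / 1) * Σab + (+ K / 1) * Σab
  diagonal-sum = begin-equality
    ∑[ i < K ] ∑[ j < K ] (a j * b j + a i * b i)
      ≡⟨ sum-cong-≗ (λ i → ∑-distrib-+ (λ j → a j * b j) (λ _ → a i * b i)) ⟩
    ∑[ i < K ] (Σab + ∑[ j < K ] (a i * b i))
      ≡⟨ sum-cong-≗ (λ i → cong (λ s → Σab + s) (sum-const K (a i * b i))) ⟩
    ∑[ i < K ] (Σab + (+ K / 1) * (a i * b i))
      ≡⟨ ∑-distrib-+ (λ _ → Σab) (λ i → (+ K / 1) * (a i * b i)) ⟩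
    ∑[ i < K ] Σab + ∑[ i < K ] ((+ K / 1) * (a i * b i))
      ≡⟨ cong₂ _+_ (sum-const K Σab) (sym (*-distribˡ-sum (+ K / 1) (λ i → a i * b i))) ⟩
    (+ K / 1) * Σab + (+ K / 1) * Σab ∎

-- The indicator of the selected slots is similarly ordered to F.
top-selection : ∀ {m K} (F : Fin K → ℚ) (sel : Fin m → Fin K) → Injective _≡_ _≡_ sel →
  (∀ a i → (∀ b → sel b ≢ i) → F i ≤ F (sel a)) →
  (+ m / 1) * sum F ≤ (+ K / 1) * ∑[ a < m ] F (sel a)
top-selection {m} {K} F sel injective dominates = subst₂ (λ x y → x * sum F ≤ (+ K / 1) * y)
  count weight (chebyshev selected F similarlyOrdered)
  where
  open ≡-Reasoning
  singletons : Fin m → Subset K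
  singletons a = ⁅ sel a ⁆
  selected : Fin K → ℚ
  selected = multiplicity singletons
  count : sum selected ≡ + m / 1
  count = begin
    sum selected                               ≡⟨ sum-cong-≗ (λ i → *-identityʳ (selected i)) ⟨
    ∑[ i < K ] (selected i * 1ℚ)               ≡⟨ sum-Σ∈≡sum-multiplicity singletons (λ _ → 1ℚ) ⟨
    ∑[ a < m ] Σ∈ ⁅ sel a ⁆ (λ _ → 1ℚ)         ≡⟨ sum-cong-≗ (λ a → Σ∈-⁅⁆ (sel a) (λ _ → 1ℚ)) ⟩
    ∑[ a < m ] 1ℚ                              ≡⟨ sum-const m 1ℚ ⟩
    (+ m / 1) * 1ℚ                             ≡⟨ *-identityʳ (+ m / 1) ⟩
    + m / 1                                    ∎
  weight : ∑[ i < K ] (selected i * F i) ≡ ∑[ a < m ] F (sel a)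
  weight = trans (sym (sum-Σ∈≡sum-multiplicity singletons F)) (sum-cong-≗ (λ a → Σ∈-⁅⁆ (sel a) F))
  disjoint : ∀ a a′ i → i ∈ ⁅ sel a ⁆ → i ∈ ⁅ sel a′ ⁆ → a ≡ a′
  disjoint a a′ i i∈a i∈a′ = injective (trans (sym (x∈⁅y⁆⇒x≡y (sel a) i∈a)) (x∈⁅y⁆⇒x≡y (sel a′) i∈a′))
  unselected : ∀ {i} → (∀ a → i ∉ ⁅ sel a ⁆) → ∀ b → sel b ≢ i
  unselected i∉ b refl = i∉ b (x∈⁅x⁆ (sel b))
  equal-factor : ∀ {x y w} z → x ≡ w → y ≡ w → (x - y) * z ≡ 0ℚ
  equal-factor {w = w} z refl refl = solve 2 (λ w z → (w :- w) :* z := con 0ℚ) refl w z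
  similarlyOrdered : ∀ i j → 0ℚ ≤ (selected j - selected i) * (F j - F i)
  similarlyOrdered i j with multiplicity-disjoint singletons disjoint j | multiplicity-disjoint singletons disjoint i
  ... | inj₁ (a , j∈ , sj) | inj₁ (_ , _ , si) = ≤-reflexive (sym (equal-factor (F j - F i) sj si))
  ... | inj₂ (_ , sj)      | inj₂ (_ , si)      = ≤-reflexive (sym (equal-factor (F j - F i) sj si))
  ... | inj₁ (a , j∈ , sj) | inj₂ (i∉ , si) rewrite sj | si | x∈⁅y⁆⇒x≡y (sel a) j∈ =
    subst (0ℚ ≤_) (solve 1 (λ w → w := (con 1ℚ :- con 0ℚ) :* w) refl (F (sel a) - F i))
      (p≤q⇒0≤q-p (dominates a i (unselected i∉)))
  ... | inj₂ (j∉ , sj) | inj₁ (a , i∈ , si) rewrite sj | si | x∈⁅y⁆⇒x≡y (sel a) i∈ =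
    subst (0ℚ ≤_) (solve 2 (λ x y → y :- x := (con 0ℚ :- con 1ℚ) :* (x :- y)) refl (F j) (F (sel a)))
      (p≤q⇒0≤q-p (dominates a j (unselected j∉)))

-- Every k satisfies (q k − u k)(p k − d c k) ≥ 0; summing, the capacity bound absorbs the d-terms.
knapsack-threshold : ∀ {n} (u q p c : Fin n → ℚ) (d : ℚ) → 0ℚ ≤ d →
  (∀ k → 0ℚ ≤ u k × u k ≤ 1ℚ) →
  (∀ k → (q k ≡ 1ℚ × d * c k ≤ p k) ⊎ (q k ≡ 0ℚ × p k ≤ d * c k)) →
  ∑[ k < n ] (u k * c k) ≤ ∑[ k < n ] (q k * c k) →
  ∑[ k < n ] (u k * p k) ≤ ∑[ k < n ] (q k * p k)
knapsack-threshold {n} u q p c d d≥0 u∈[0,1] threshold capacity = +-cancelʳ-≤ (d * Σqc) (begin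
  Σup + d * Σqc                                      ≡⟨ cong (λ s → Σup + s) (*-distribˡ-sum d (λ k → q k * c k)) ⟩
  Σup + ∑[ k < n ] (d * (q k * c k))                 ≡⟨ ∑-distrib-+ (λ k → u k * p k) (λ k → d * (q k * c k)) ⟨
  ∑[ k < n ] (u k * p k + d * (q k * c k))           ≤⟨ sum-mono-≤ exchange ⟩
  ∑[ k < n ] (q k * p k + d * (u k * c k))           ≡⟨ ∑-distrib-+ (λ k → q k * p k) (λ k → d * (u k * c k)) ⟩
  Σqp + ∑[ k < n ] (d * (u k * c k))                 ≡⟨ cong (λ s → Σqp + s) (*-distribˡ-sum d (λ k → u k * c k)) ⟨
  Σqp + d * ∑[ k < n ] (u k * c k)                   ≤⟨ +-monoʳ-≤ Σqp (*-monoˡ-≤-nonNeg d {{nonNegative d≥0}} capacity) ⟩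
  Σqp + d * Σqc                                      ∎)
  where
  open ≤-Reasoning
  Σup = ∑[ k < n ] (u k * p k)
  Σqp = ∑[ k < n ] (q k * p k)
  Σqc = ∑[ k < n ] (q k * c k)
  gain : ∀ k → 0ℚ ≤ (q k - u k) * (p k - d * c k)
  gain k with threshold k
  ... | inj₁ (qk≡1 , dc≤p) rewrite qk≡1 =
    nonNeg*nonNeg (p≤q⇒0≤q-p (proj₂ (u∈[0,1] k))) (p≤q⇒0≤q-p dc≤p)
  ... | inj₂ (qk≡0 , p≤dc) rewrite qk≡0 =
    subst (0ℚ ≤_) (solve 3 (λ u p dc → u :* (dc :- p) := (con 0ℚ :- u) :* (p :- dc)) refl (u k) (p k) (d * c k))
      (nonNeg*nonNeg (proj₁ (u∈[0,1] k)) (p≤q⇒0≤q-p p≤dc))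
  exchange : ∀ k → u k * p k + d * (q k * c k) ≤ q k * p k + d * (u k * c k)
  exchange k = 0≤q-p⇒p≤q (subst (0ℚ ≤_)
    (solve 5 (λ u q p d c → (q :- u) :* (p :- d :* c) := q :* p :+ d :* (u :* c) :- (u :* p :+ d :* (q :* c)))
           refl (u k) (q k) (p k) d (c k))
    (gain k))

module _ {n} (I : Instance n) where
  open Instance I
  open import Data.List.Membership.DecPropositional (_≟ᶠ_ {n}) using () renaming (_∈?_ to _∈ˡ?_)

  Denser : Fin n → Fin n → Set
  Denser j k = density I k ≤ density I j

  density-nonNeg : ∀ k → 0ℚ ≤ density I k
  density-nonNeg k = nonNeg*nonNeg (p≥0 k) (<⇒≤ (positive⁻¹ _ {{1/pos⇒pos (c k) {{positive (c>0 k)}}}}))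

  density*c : ∀ k → density I k * c k ≡ p k
  density*c k = begin
    p k * 1/ c k * c k      ≡⟨ *-assoc (p k) (1/ c k) (c k) ⟩
    p k * (1/ c k * c k)    ≡⟨ cong (p k *_) (*-inverseˡ (c k)) ⟩
    p k * 1ℚ                ≡⟨ *-identityʳ (p k) ⟩
    p k                     ∎
    where
    open ≡-Reasoning
    instance
      c≢0 = >-nonZero (c>0 k)

  ≤density⇒*c≤p : ∀ {d} k → d ≤ density I k → d * c k ≤ p k
  ≤density⇒*c≤p k h = subst (_ ≤_) (density*c k) (*-monoʳ-≤-nonNeg (c k) {{nonNegative (<⇒≤ (c>0 k))}} h)

  density≤⇒p≤*c : ∀ {d} k → density I k ≤ d → p k ≤ d * c k
  density≤⇒p≤*c k h = subst (_≤ _) (density*c k) (*-monoʳ-≤-nonNeg (c k) {{nonNegative (<⇒≤ (c>0 k))}} h)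

  W-nonNeg : ∀ S → 0ℚ ≤ W I S
  W-nonNeg S = Σ∈-nonNeg S (λ k → <⇒≤ (c>0 k))

  P-nonNeg : ∀ S → 0ℚ ≤ P I S
  P-nonNeg S = Σ∈-nonNeg S p≥0

  update-same : ∀ {K} {A : Set} (f : Fin K → A) i x → update I f i x i ≡ x
  update-same f i x rewrite dec-true (i ≟ᶠ i) refl = refl

  record LoopInvariant {K} (s : AlgState I K) (pending : List (Fin n)) : Set where
    field
      pending-unassigned : ∀ {k} → k ∈ˡ pending → ∀ i → k ∉ S s i
      processed-once     : ∀ {k} → k ∉ˡ pending → multiplicity (S s) k ≡ 1ℚ
      closed-overfull    : ∀ {i j} → L s i ≡ just j → B < W I (S s i) × j ∈ S s i
      pending-distinct   : Unique pending
      pending-sorted     : AllPairs Denser pending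
      processed-denser   : ∀ {k k′} → k ∉ˡ pending → k′ ∈ˡ pending → Denser k k′

  module _ {K} {s : AlgState I K} {j js} (inv : LoopInvariant s (j ∷ js)) (i : Fin K) where
    open LoopInvariant inv

    private
      S′ : Fin K → Subset n
      S′ = update I (S s) i (S s i ∪ ⁅ j ⁆)

      j∈S′ : j ∈ S′ i
      j∈S′ = subst (j ∈_) (sym (update-same (S s) i _)) (x∈p∪q⁺ (inj₂ (x∈⁅x⁆ j)))

      pending≢j : ∀ {k} → k ∈ˡ js → k ≢ j
      pending≢j k∈js = ≢-sym (All.lookup (AllPairs.head pending-distinct) k∈js)

      processed-before : ∀ {k} → k ≢ j → k ∉ˡ js → k ∉ˡ j ∷ js
      processed-before k≢j k∉js (here k≡j)  = k≢j k≡j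
      processed-before k≢j k∉js (there k∈js) = k∉js k∈js

      lookup-S′ : ∀ {k} → k ≢ j → ∀ i′ → lookup (S′ i′) k ≡ lookup (S s i′) k
      lookup-S′ k≢j i′ with i′ ≟ᶠ i
      ... | yes refl = lookup-∪-⁅⁆ (S s i) k≢j
      ... | no  _    = refl

    invariant-after-adding : ∀ {L′} → (∀ {i′ j′} → L′ i′ ≡ just j′ → B < W I (S′ i′) × j′ ∈ S′ i′) →
      LoopInvariant ⟨ S′ , L′ ⟩ js
    invariant-after-adding closed = record
      { pending-unassigned = unassigned
      ; processed-once     = once
      ; closed-overfull    = closed
      ; pending-distinct   = AllPairs.tail pending-distinct
      ; pending-sorted     = AllPairs.tail pending-sorted
      ; processed-denser   = denser
      }
      where
      unassigned : ∀ {k} → k ∈ˡ js → ∀ i′ → k ∉ S′ i′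
      unassigned k∈js i′ k∈S′ with i′ ≟ᶠ i
      ... | no _ = pending-unassigned (there k∈js) i′ k∈S′
      ... | yes refl with x∈p∪q⁻ (S s i) ⁅ j ⁆ k∈S′
      ...   | inj₁ k∈S = pending-unassigned (there k∈js) i k∈S
      ...   | inj₂ k∈j = pending≢j k∈js (x∈⁅y⁆⇒x≡y j k∈j)
      once : ∀ {k} → k ∉ˡ js → multiplicity S′ k ≡ 1ℚ
      once {k} k∉js with k ≟ᶠ j
      ... | yes refl = multiplicity-unique S′ j∈S′ only-i
        where
        only-i : ∀ i′ → j ∈ S′ i′ → i′ ≡ i
        only-i i′ j∈S′i′ with i′ ≟ᶠ i
        ... | yes i′≡i = i′≡i
        ... | no  _    = ⊥-elim (pending-unassigned (here refl) i′ j∈S′i′)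
      ... | no k≢j = trans (sum-cong-≗ (cong χ ∘ lookup-S′ k≢j)) (processed-once (processed-before k≢j k∉js))
      denser : ∀ {k k′} → k ∉ˡ js → k′ ∈ˡ js → Denser k k′
      denser {k} k∉js k′∈js with k ≟ᶠ j
      ... | yes refl = All.lookup (AllPairs.head pending-sorted) k′∈js
      ... | no k≢j   = processed-denser (processed-before k≢j k∉js) (there k′∈js)

    closed-after-fit : L s i ≡ nothing → ∀ {i′ j′} → L s i′ ≡ just j′ → B < W I (S′ i′) × j′ ∈ S′ i′
    closed-after-fit open-i {i′} closed-i′ with i′ ≟ᶠ i
    ... | yes refl = contradiction (trans (sym open-i) closed-i′) λ ()
    ... | no  _    = closed-overfull closed-i′

    closed-after-close : B < W I (S s i ∪ ⁅ j ⁆) → ∀ {i′ j′} → update I (L s) i (just j) i′ ≡ just j′ →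
      B < W I (S′ i′) × j′ ∈ S′ i′
    closed-after-close overfull {i′} closed-i′ with i′ ≟ᶠ i
    ... | yes refl with refl ← closed-i′ = overfull , x∈p∪q⁺ (inj₂ (x∈⁅x⁆ j))
    ... | no  _    = closed-overfull closed-i′

  data Outcome {K} (m : ℕ) (s : AlgState I K) : Set where
    exhausted : LoopInvariant s [] → Outcome m s
    halted    : ∀ {j js} → LoopInvariant s (j ∷ js) → ∣ closedSlots I s ∣ ≡ m → Outcome m s

  outcome-invariant : ∀ {K m} {s : AlgState I K} → Outcome m s → ∃[ js ] LoopInvariant s js
  outcome-invariant (exhausted inv) = [] , inv
  outcome-invariant (halted inv _)  = _ , inv

  loop-outcome : ∀ {K m} {s s′ : AlgState I K} {js} → Loop I m s js s′ → LoopInvariant s js → Outcome m s′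
  loop-outcome finished                           inv = exhausted inv
  loop-outcome (stop all-closed)                  inv = halted inv all-closed
  loop-outcome (addFit i _ open-i _ _ run)        inv =
    loop-outcome run (invariant-after-adding inv i (closed-after-fit inv i open-i))
  loop-outcome (addClose i _ _ _ overfull run)    inv =
    loop-outcome run (invariant-after-adding inv i (closed-after-close inv i overfull))

  initial-invariant : ∀ K {ord} → DensityOrder I ord → LoopInvariant (initState I K) ord
  initial-invariant K {ord} (ord↭all , sorted) = record
    { pending-unassigned = λ _ _ → ∉⊥
    ; processed-once     = λ k∉ord → ⊥-elim (k∉ord (in-ord _))
    ; closed-overfull    = λ ()
    ; pending-distinct   = Unique-resp-↭ (↭⇒↭ₛ (↭-sym ord↭all)) (allFin⁺ n)
    ; pending-sorted     = Linked⇒AllPairs (λ j≥k k≥l → ≤-trans k≥l j≥k) sorted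
    ; processed-denser   = λ k∉ord _ → ⊥-elim (k∉ord (in-ord _))
    }
    where
    open import Data.List.Relation.Binary.Permutation.Setoid.Properties (setoid (Fin n)) using (Unique-resp-↭)
    in-ord : ∀ k → k ∈ˡ ord
    in-ord k = ∈-resp-↭ (↭-sym ord↭all) (∈-allFin k)

  closed-weight : ∀ {K} (s : AlgState I K) → (∀ {i j} → L s i ≡ just j → B < W I (S s i)) →
    (+ ∣ closedSlots I s ∣ / 1) * B ≤ ∑[ i < K ] W I (S s i)
  closed-weight {ℕ.zero}  s overfull = ≤-reflexive (*-zeroˡ B)
  closed-weight {ℕ.suc K} s overfull with L s zero in L₀
  ... | just j  = begin
    (+ ℕ.suc closed / 1) * B     ≡⟨ cong (_* B) (/1-homo-+ 1 closed) ⟩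
    (1ℚ + + closed / 1) * B      ≡⟨ *-distribʳ-+ B 1ℚ (+ closed / 1) ⟩
    1ℚ * B + (+ closed / 1) * B  ≡⟨ cong (_+ (+ closed / 1) * B) (*-identityˡ B) ⟩
    B + (+ closed / 1) * B       ≤⟨ +-mono-≤ (<⇒≤ (overfull L₀)) rest ⟩
    W I (S s zero) + ∑[ i < K ] W I (S s (suc i)) ∎
    where
    open ≤-Reasoning
    closed = ∣ closedSlots I ⟨ S s ∘ suc , L s ∘ suc ⟩ ∣
    rest = closed-weight ⟨ S s ∘ suc , L s ∘ suc ⟩ overfull
  ... | nothing = subst (_≤ W I (S s zero) + ∑[ i < K ] W I (S s (suc i))) (+-identityˡ _)
    (+-mono-≤ (W-nonNeg (S s zero)) rest)
    where
    rest = closed-weight ⟨ S s ∘ suc , L s ∘ suc ⟩ overfull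

  final-halves : ∀ {K} (s : AlgState I K) i → (∀ {j} → L s i ≡ just j → j ∈ S s i) →
    P I (S s i) ≤ P I (finalSet I s i) + P I (finalSet I s i)
  final-halves s i closed-member with L s i
  ... | nothing = subst (_≤ P I (S s i) + P I (S s i)) (+-identityʳ _) (+-monoʳ-≤ (P I (S s i)) (P-nonNeg (S s i)))
  ... | just j  = keeping-larger (P I ⁅ j ⁆ ≤? P I (S s i ─ ⁅ j ⁆))
    where
    rest = S s i ─ ⁅ j ⁆
    split : P I (S s i) ≡ P I rest + P I ⁅ j ⁆
    split = Σ∈-split p (closed-member refl)
    keeping-larger : (larger? : Dec (P I ⁅ j ⁆ ≤ P I rest)) →
      P I (S s i) ≤ P I (if does larger? then rest else ⁅ j ⁆) + P I (if does larger? then rest else ⁅ j ⁆)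
    keeping-larger (yes last≤rest) = subst (_≤ P I rest + P I rest) (sym split) (+-monoʳ-≤ (P I rest) last≤rest)
    keeping-larger (no  last≰rest) =
      subst (_≤ P I ⁅ j ⁆ + P I ⁅ j ⁆) (sym split) (+-monoˡ-≤ (P I ⁅ j ⁆) (<⇒≤ (≰⇒> last≰rest)))

  greedy-dominates : ∀ {K m} {s : AlgState I K} → Outcome m s → (u : Fin n → ℚ) →
    (∀ k → 0ℚ ≤ u k × u k ≤ 1ℚ) → ∑[ k < n ] (u k * c k) ≤ (+ m / 1) * B →
    ∑[ k < n ] (u k * p k) ≤ ∑[ k < n ] (multiplicity (S s) k * p k)
  greedy-dominates {s = s} (exhausted inv) u u∈[0,1] _ =
    knapsack-threshold u (multiplicity (S s)) p c 0ℚ ≤-refl u∈[0,1]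
      (λ k → inj₁ (all-once k , subst (_≤ p k) (sym (*-zeroˡ (c k))) (p≥0 k)))
      (sum-mono-≤ u*c≤q*c)
    where
    open LoopInvariant inv
    all-once : ∀ k → multiplicity (S s) k ≡ 1ℚ
    all-once k = processed-once λ ()
    u*c≤q*c : ∀ k → u k * c k ≤ multiplicity (S s) k * c k
    u*c≤q*c k = subst (λ q → u k * c k ≤ q * c k) (sym (all-once k))
      (*-monoʳ-≤-nonNeg (c k) {{nonNegative (<⇒≤ (c>0 k))}} (proj₂ (u∈[0,1] k)))
  greedy-dominates {K} {m} {s} (halted {j} {js} inv all-closed) u u∈[0,1] capacity =
    knapsack-threshold u (multiplicity (S s)) p c (density I j) (density-nonNeg j) u∈[0,1] threshold (begin
      ∑[ k < n ] (u k * c k)                         ≤⟨ capacity ⟩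
      (+ m / 1) * B                                  ≡⟨ cong (λ x → (+ x / 1) * B) all-closed ⟨
      (+ ∣ closedSlots I s ∣ / 1) * B                ≤⟨ closed-weight s (proj₁ ∘ closed-overfull) ⟩
      ∑[ i < K ] W I (S s i)                         ≡⟨ sum-Σ∈≡sum-multiplicity (S s) c ⟩
      ∑[ k < n ] (multiplicity (S s) k * c k)        ∎)
    where
    open LoopInvariant inv
    open ≤-Reasoning
    pending-below : ∀ {k} → k ∈ˡ j ∷ js → Denser j k
    pending-below (here refl) = ≤-refl
    pending-below (there k∈js) = All.lookup (AllPairs.head pending-sorted) k∈js
    threshold : ∀ k → (multiplicity (S s) k ≡ 1ℚ × density I j * c k ≤ p k)
                    ⊎ (multiplicity (S s) k ≡ 0ℚ × p k ≤ density I j * c k)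
    threshold k with k ∈ˡ? (j ∷ js)
    ... | yes k∈ = inj₂ (multiplicity-none (S s) (pending-unassigned k∈) , density≤⇒p≤*c k (pending-below k∈))
    ... | no  k∉ = inj₁ (processed-once k∉ , ≤density⇒*c≤p k (processed-denser k∉ (here refl)))

  admissible-fraction : ∀ {m} (T : Fin m → Subset n) → Admissible I m T →
    ∀ k → 0ℚ ≤ multiplicity T k × multiplicity T k ≤ 1ℚ
  admissible-fraction T (disjoint , _) k with multiplicity-disjoint T disjoint k
  ... | inj₁ (_ , _ , once) = subst (0ℚ ≤_) (sym once) (nonNegative⁻¹ 1ℚ) , ≤-reflexive once
  ... | inj₂ (_ , never)    = ≤-reflexive (sym never) , subst (_≤ 1ℚ) (sym never) (nonNegative⁻¹ 1ℚ)

  admissible-capacity : ∀ {m} (T : Fin m → Subset n) → Admissible I m T →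
    ∑[ k < n ] (multiplicity T k * c k) ≤ (+ m / 1) * B
  admissible-capacity {m} T (_ , feasible) = begin
    ∑[ k < n ] (multiplicity T k * c k)   ≡⟨ sum-Σ∈≡sum-multiplicity T c ⟨
    ∑[ a < m ] W I (T a)                  ≤⟨ sum-mono-≤ (proj₂ ∘ feasible) ⟩
    ∑[ a < m ] B                          ≡⟨ sum-const m B ⟩
    (+ m / 1) * B                         ∎
    where open ≤-Reasoning

  greedy-half : ∀ {m K ord} {s : AlgState I K} → DensityOrder I ord → Loop I m (initState I K) ord s →
    ∀ {T} → Admissible I m T →
    ∑[ a < m ] P I (T a) ≤ ∑[ i < K ] P I (finalSet I s i) + ∑[ i < K ] P I (finalSet I s i)
  greedy-half {m} {K} {s = s} ordered run {T} admissible = begin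
    ∑[ a < m ] P I (T a)                            ≡⟨ sum-Σ∈≡sum-multiplicity T p ⟩
    ∑[ k < n ] (multiplicity T k * p k)             ≤⟨ greedy-dominates outcome (multiplicity T)
                                                         (admissible-fraction T admissible)
                                                         (admissible-capacity T admissible) ⟩
    ∑[ k < n ] (multiplicity (S s) k * p k)         ≡⟨ sum-Σ∈≡sum-multiplicity (S s) p ⟨
    ∑[ i < K ] P I (S s i)                          ≤⟨ sum-mono-≤ (λ i → final-halves s i (proj₂ ∘ closed-overfull)) ⟩
    ∑[ i < K ] (F i + F i)                          ≡⟨ ∑-distrib-+ F F ⟩
    ∑[ i < K ] F i + ∑[ i < K ] F i                 ∎
    where
    open ≤-Reasoning
    F = P I ∘ finalSet I s
    outcome = loop-outcome run (initial-invariant K ordered)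
    open LoopInvariant (proj₂ (outcome-invariant outcome))

lemma5 : ∀ {n : ℕ} (I : Instance n) (m Δ : ℕ) → IsMaxDegree I Δ →
    ∀ (fm : ℚ) → IsOptimum I m fm →
    ∀ (out : Fin m → Subset n) → GreedyOutput I m Δ out →
    (+ m / 1) * fm ≤ (+ (2 Data.Nat.* (m Data.Nat.+ Δ)) / 1) * Σᶠ (λ i → P I (out i))
lemma5 I m Δ _ fm ((T , admissible , P[T]≡fm) , _) out
       (ord , ordered , s , run , sel , (injective , dominates) , out≡) = begin
  (+ m / 1) * fm                              ≡⟨ cong ((+ m / 1) *_) (trans (sym P[T]≡fm) (Σᶠ≡sum (P I ∘ T))) ⟩
  (+ m / 1) * ∑[ a < m ] P I (T a)            ≤⟨ *-monoˡ-≤-nonNeg (+ m / 1) {{normalize-nonNeg m 1}}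
                                                   (greedy-half I ordered run admissible) ⟩
  (+ m / 1) * (sum F + sum F)                 ≡⟨ *-distribˡ-+ (+ m / 1) (sum F) (sum F) ⟩
  (+ m / 1) * sum F + (+ m / 1) * sum F       ≤⟨ +-mono-≤ top top ⟩
  (+ K / 1) * Σout + (+ K / 1) * Σout         ≡⟨ *-distribʳ-+ Σout (+ K / 1) (+ K / 1) ⟨
  (+ K / 1 + + K / 1) * Σout                  ≡⟨ cong (_* Σout) (/1-homo-+ K K) ⟨
  (+ (K ℕ.+ K) / 1) * Σout                    ≡⟨ cong (λ k → (+ (K ℕ.+ k) / 1) * Σout) (ℕ.+-identityʳ K) ⟨
  (+ (2 ℕ.* K) / 1) * Σout                    ∎
  where
  open ≤-Reasoning
  K = m ℕ.+ Δ
  F = P I ∘ finalSet I s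
  Σout = Σᶠ (λ i → P I (out i))
  top : (+ m / 1) * sum F ≤ (+ K / 1) * Σout
  top = subst (λ x → (+ m / 1) * sum F ≤ (+ K / 1) * x)
    (trans (sum-cong-≗ (cong (P I) ∘ sym ∘ out≡)) (sym (Σᶠ≡sum (P I ∘ out))))
    (top-selection F sel injective dominates)
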